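{- Let $n\ge 1$ and let $\rho\in S_{2n}$ be a fixed-point-free involution of $[\bar n]$. Let $i,j\in[\bar n]$ with $i\notin\{j,\bar j\}$. Then: (1) the transposition $(i\ j)$ makes a cut for $\rho$ if and only if the transposition $(\bar i\ j)$ makes a twist for $\rho$; (2) $(i\ j)$ makes a join for $\rho$ if and only if $(\bar i\ j)$ makes a join for $\rho$, and in this case the types of $(i\ j).\rho$ and $(\bar i\ j).\rho$ coincide.
   Context: Let $[\bar n]=\{1,\bar 1,2,\bar 2,\dots,n,\bar n\}$ and let $S_{2n}$ be the symmetric group on $[\bar n]$. The bar is the involution $x\mapsto\bar x$ of $[\bar n]$ exchanging $i$ and $\bar i$ (so $\bar{\bar i}=i$). Let $\tau=(1\ \bar 1)(2\ \bar 2)\cdots(n\ \bar n)$. For a fixed-point-free involution $\rho\in S_{2n}$, let $\rho\cup\tau$ be the graph on the vertex set $[\bar n]$ whose edges are the pairs $\{x,\rho(x)\}$ and $\{x,\tau(x)\}$; its connected components are cycles with $2\lambda_1,\dots,2\lambda_\ell$ vertices, and the partition $\lambda=(\lambda_1,\dots,\lambda_\ell)\vdash n$ is the type of $\rho$ (equivalently, $\rho\tau$ has cycle type $\lambda\cup\lambda$). The group $S_{2n}$ acts on fixed-point-free involutions by conjugation, $\sigma.\rho=\sigma\rho\sigma^{ -1}$. For a transposition $\sigma$: $\sigma$ makes a cut for $\rho$ if the type of $\sigma.\rho$ has one more part than the type of $\rho$; a join if it has one fewer part; a twist if $\sigma.\rho$ and $\rho$ have the same type. -}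

module Defs where

open import Data.Nat using (ℕ; zero; suc; _*_; _/_)
open import Data.Nat.Properties using (≤-decTotalOrder)
open import Data.Fin using (Fin)
open import Data.Fin.Properties using () renaming (_≟_ to _≟ᶠ_)
open import Data.Bool using (Bool; true; false; not; _∨_; if_then_else_)
open import Data.Bool.Properties using () renaming (_≟_ to _≟ᵇ_)
open import Data.Product using (_×_; _,_; map₂)
open import Data.Product.Properties using (≡-dec)
open import Data.List using (List; []; _∷_; length; filter; map; concatMap; reverse)
open import Data.Bool.ListAction using (any)
open import Data.Fin using (Fin)
open import Data.List.Base using (allFin)
open import Data.Maybe using (Maybe; just; nothing)
open import Relation.Binary.PropositionalEquality using (_≡_; _≢_)
open import Relation.Nullary using (Dec; yes; no; does; ¬_)
open import Relation.Nullary.Decidable using (⌊_⌋)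
open import Data.List.Sort.MergeSort ≤-decTotalOrder using (sort)

-- The vertex set [n̄]: (i , true) stands for i, (i , false) for ī.
V : ℕ → Set
V n = Fin n × Bool

bar : ∀ {n} → V n → V n
bar = map₂ not

_≟_ : ∀ {n} (x y : V n) → Dec (x ≡ y)
_≟_ = ≡-dec _≟ᶠ_ _≟ᵇ_

_==_ : ∀ {n} (x y : V n) → Bool
x == y = ⌊ x ≟ y ⌋

-- ρ is a fixed-point-free involution of [n̄] (an involution is automatically a
-- bijection, i.e. an element of S_{2n})
IsFPFInvolution : ∀ {n} → (V n → V n) → Set
IsFPFInvolution ρ = (∀ x → ρ (ρ x) ≡ x) × (∀ x → ρ x ≢ x)

transp : ∀ {n} → V n → V n → V n → V n
transp a b x = if x == a then b else (if x == b then a else x)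

act : ∀ {n} → V n → V n → (V n → V n) → (V n → V n)
act a b ρ x = transp a b (ρ (transp a b x))

verts : ∀ n → List (V n)
verts n = concatMap (λ i → (i , true) ∷ (i , false) ∷ []) (allFin n)

adj : ∀ {n} → (V n → V n) → V n → V n → Bool
adj ρ x y = (y == ρ x) ∨ (x == ρ y) ∨ (y == bar x) ∨ (x == bar y)

step : ∀ {n} → (V n → V n) → List (V n) → List (V n)
step {n} ρ S = filter (λ y → any (λ s → (y == s) ∨ adj ρ s y) S ≟ᵇ true) (verts n)

iter : ℕ → {A : Set} → (A → A) → A → A
iter zero f a = a
iter (suc k) f a = f (iter k f a)

-- the connected component of x in ρ ∪ τ (a graph on 2n vertices, so 2n
-- closure steps suffice), listed in the order of verts
comp : ∀ {n} → (V n → V n) → V n → List (V n)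
comp {n} ρ x = iter (2 * n) (step ρ) (x ∷ [])

isRep : ∀ {n} → (V n → V n) → V n → Bool
isRep ρ x with comp ρ x
... | [] = false
... | y ∷ _ = y == x

reps : ∀ {n} → (V n → V n) → List (V n)
reps {n} ρ = filter (λ x → isRep ρ x ≟ᵇ true) (verts n)

-- the type of ρ: the partition λ with components of sizes 2λ₁,…,2λ_ℓ,
-- as a weakly decreasing list
type : ∀ {n} → (V n → V n) → List ℕ
type ρ = reverse (sort (map (λ x → length (comp ρ x) / 2) (reps ρ)))

MakesCut : ∀ {n} → (V n → V n) → V n → V n → Set
MakesCut ρ a b = length (type (act a b ρ)) ≡ suc (length (type ρ))

MakesJoin : ∀ {n} → (V n → V n) → V n → V n → Set
MakesJoin ρ a b = suc (length (type (act a b ρ))) ≡ length (type ρ)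

MakesTwist : ∀ {n} → (V n → V n) → V n → V n → Set
MakesTwist ρ a b = type (act a b ρ) ≡ type ρ

{-# OPTIONS --safe #-}
module Submission where

-- The components of ρ ∪ τ are cycles alternating between ρ-edges and τ-edges, and the type
-- only depends on which vertices they connect. Conjugating by (a b) rewires the ρ-edges at a
-- and b: if a and b lie on different cycles these merge into one (a join); otherwise a and b
-- either end up on two separate cycles (a cut) or on one cycle with the old vertex set (a twist).
-- Since i and ī always share a cycle, (i j) joins exactly when (ī j) does, and both then
-- produce the same merged component. If j lies on the cycle of i, one of (i j), (ī j) splits
-- it, seen by walking the cycle from i to the first visit of j; and since
-- (ī j) = (i j)(i ī)(i j) with (i ī) commuting with τ, (i j) and (ī j) cannot both split it.

open import Defs
open import Level using (0ℓ)
open import Data.Nat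
  using (ℕ; zero; suc; pred; _+_; _*_; _/_; _≤_; _<_; _≤′_; ≤′-refl; ≤′-step; z≤n; s≤s)
open import Data.Nat.Properties
  using (≤-decTotalOrder; ≤-refl; ≤-trans; <-irrefl; <-asym; ≤-reflexive; n≤1+n; n<1+n; m≤n+m;
         <⇒≤; ≤-<-trans; ≤-total; ≤⇒≤′; m≤n⇒m<n∨m≡n; m≤n⇒∃[o]m+o≡n; +-comm; +-suc; +-identityʳ;
         +-mono-≤)
open import Data.Fin using (Fin; toℕ)
open import Data.Fin.Properties using (pigeonhole; toℕ≤pred[n])
open import Data.Bool using (true; false; T; _∨_)
open import Data.Bool.Properties using (not-involutive; T-∨; T-≡) renaming (_≟_ to _≟ᵇ_)
open import Data.Bool.ListAction using (any)
open import Data.Product as Product using (_×_; _,_; proj₁; proj₂; ∃-syntax)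
open import Data.Sum as Sum using (_⊎_; inj₁; inj₂; [_,_]′)
open import Data.List using (List; []; _∷_; length; filter; map; reverse; allFin; head)
open import Data.List.Relation.Unary.Any as Any using (here; there; any?)
open import Data.List.Relation.Unary.Any.Properties using (any⁺; any⁻)
open import Data.List.Membership.Propositional using (_∈_; find; lose)
open import Data.List.Properties
  using (filter-≐; filter-accept; filter-reject; map-cong; length-map; length-reverse)
open import Data.List.Sort.MergeSort ≤-decTotalOrder using (sort)
open import Data.List.Sort.MergeSort.Properties ≤-decTotalOrder using (sort-↭)
open import Data.List.Relation.Binary.Permutation.Propositional.Properties using (↭-length)
open import Data.List.Membership.Propositional.Properties
  using (∈-filter⁺; ∈-filter⁻; ∈-concatMap⁺; ∈-allFin)
open import Data.List.Relation.Unary.All as All using (All; []; _∷_)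
import Data.List.Relation.Unary.All.Properties as All
import Data.List.Relation.Unary.AllPairs as AllPairs
import Data.List.Relation.Unary.AllPairs.Properties as AllPairs
open import Data.List.Relation.Unary.Unique.Propositional using (Unique)
open import Data.List.Relation.Unary.Unique.Propositional.Properties using (concat⁺; allFin⁺)
open import Data.List.Relation.Binary.Disjoint.Propositional using (Disjoint)
open import Data.Maybe using (just)
open import Data.Maybe.Properties using (just-injective)
open import Function using (_∘_; id; _⇔_; mk⇔; Equivalence)
open import Data.Empty using (⊥-elim)
open import Relation.Binary using (Rel; IsEquivalence; _⇒_)
open import Relation.Binary.Construct.Closure.Symmetric using (SymClosure; fwd; bwd)
open import Relation.Binary.Construct.Closure.ReflexiveTransitive using (ε; _◅_; _◅◅_)
open import Relation.Binary.Construct.Closure.Equivalence as EqClosure using (EqClosure)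
open import Relation.Binary.PropositionalEquality
  using (_≡_; _≢_; _≗_; refl; sym; trans; cong; cong₂; subst; subst₂; module ≡-Reasoning)
open import Relation.Nullary using (¬_; Dec; yes; no; contradiction)
open import Relation.Nullary.Decidable using (toWitness; fromWitness; toSum; map′)
open import Relation.Unary using (Pred; Decidable)
open import Function.Properties.Equivalence using (⇔-isEquivalence)

private variable
  n : ℕ
  a a′ b i j x y z : V n
  ρ : V n → V n

iter-+ : {A : Set} (f : A → A) (d k : ℕ) (a : A) → iter (d + k) f a ≡ iter d f (iter k f a)
iter-+ f zero k a = refl
iter-+ f (suc d) k a = cong f (iter-+ f d k a)

iter-comm : {A : Set} (f : A → A) (d : ℕ) (a : A) → iter d f (f a) ≡ f (iter d f a)
iter-comm f zero a = refl
iter-comm f (suc d) a = cong f (iter-comm f d a)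

least : {P : Pred ℕ 0ℓ} → Decidable P → ∀ {s} → P s →
        ∃[ l ] l ≤ s × P l × (∀ {k} → k < l → ¬ P k)
least P? {s} Ps with P? 0
... | yes P0 = 0 , z≤n , P0 , λ ()
least P? {zero} Ps | no ¬P0 = contradiction Ps ¬P0
least P? {suc s} Ps | no ¬P0 with least (P? ∘ suc) Ps
... | l , l≤s , Pl , below = suc l , s≤s l≤s , Pl , λ { {zero} _ → ¬P0 ; {suc k} (s≤s k<l) → below k<l }

head-∈ : {A : Set} {xs : List A} {x : A} → x ∈ xs → ∃[ m ] head xs ≡ just m × m ∈ xs
head-∈ {xs = m ∷ _} _ = m , refl , here refl

module _ {A : Set} {P Q : Pred A 0ℓ} (P? : Decidable P) (Q? : Decidable Q) where

  filter-cong-All : ∀ {xs} → All (λ x → P x ⇔ Q x) xs → filter P? xs ≡ filter Q? xs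
  filter-cong-All [] = refl
  filter-cong-All {x ∷ xs} (P⇔Q ∷ rest) with P? x
  ... | yes p rewrite filter-accept Q? {xs = xs} (Equivalence.to P⇔Q p) = cong (x ∷_) (filter-cong-All rest)
  ... | no ¬p rewrite filter-reject Q? {xs = xs} (¬p ∘ Equivalence.from P⇔Q) = filter-cong-All rest

  length-filter-except : ∀ {d xs} → Unique xs → d ∈ xs → P d → ¬ Q d → (∀ {x} → x ≢ d → P x ⇔ Q x) →
                         length (filter P? xs) ≡ suc (length (filter Q? xs))
  length-filter-except {xs = d ∷ xs} (d∉xs AllPairs.∷ _) (here refl) Pd ¬Qd P⇔Q
    rewrite filter-accept P? {xs = xs} Pd | filter-reject Q? {xs = xs} ¬Qd =
    cong (suc ∘ length) (filter-cong-All (All.map (λ d≢x → P⇔Q (d≢x ∘ sym)) d∉xs))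
  length-filter-except {xs = x ∷ xs} (x∉xs AllPairs.∷ xs-unique) (there d∈xs) Pd ¬Qd P⇔Q
    with P? x | All.lookup x∉xs d∈xs
  ... | yes p | x≢d rewrite filter-accept Q? {xs = xs} (Equivalence.to (P⇔Q x≢d) p) =
    cong suc (length-filter-except xs-unique d∈xs Pd ¬Qd P⇔Q)
  ... | no ¬p | x≢d rewrite filter-reject Q? {xs = xs} (¬p ∘ Equivalence.from (P⇔Q x≢d)) =
    length-filter-except xs-unique d∈xs Pd ¬Qd P⇔Q

  head-filter-⊎ : {R : Pred A 0ℓ} (R? : Decidable R) → (∀ {x} → R x ⇔ (P x ⊎ Q x)) → ∀ xs →
                  head (filter R? xs) ≡ head (filter P? xs) ⊎ head (filter R? xs) ≡ head (filter Q? xs)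
  head-filter-⊎ R? R⇔ [] = inj₁ refl
  head-filter-⊎ R? R⇔ (x ∷ xs) with P? x | Q? x
  ... | yes p | _ rewrite filter-accept R? {xs = xs} (Equivalence.from R⇔ (inj₁ p)) = inj₁ refl
  ... | no _ | yes q rewrite filter-accept R? {xs = xs} (Equivalence.from R⇔ (inj₂ q)) = inj₂ refl
  ... | no ¬p | no ¬q rewrite filter-reject R? {xs = xs} ([ ¬p , ¬q ]′ ∘ Equivalence.to R⇔) =
    head-filter-⊎ R? R⇔ xs

bar-involutive : (x : V n) → bar (bar x) ≡ x
bar-involutive (i , s) = cong (i ,_) (not-involutive s)

bar-≢ : (x : V n) → bar x ≢ x
bar-≢ (_ , true) ()
bar-≢ (_ , false) ()

≢bar⇒bar≢ : x ≢ bar y → bar x ≢ y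
≢bar⇒bar≢ {x = x} x≢ȳ x̄≡y = x≢ȳ (trans (sym (bar-involutive x)) (cong bar x̄≡y))

bar-injective : bar x ≡ bar y → x ≡ y
bar-injective {x = x} {y} e = trans (sym (bar-involutive x)) (trans (cong bar e) (bar-involutive y))

same-fibre : {y z : V n} → proj₁ y ≡ proj₁ z → y ≡ z ⊎ y ≡ bar z
same-fibre {y = i , true} {.i , true} refl = inj₁ refl
same-fibre {y = i , true} {.i , false} refl = inj₂ refl
same-fibre {y = i , false} {.i , true} refl = inj₂ refl
same-fibre {y = i , false} {.i , false} refl = inj₁ refl

==-refl : (x : V n) → (x == x) ≡ true
==-refl x with x ≟ x
... | yes _ = refl
... | no x≢x = contradiction refl x≢x

==-≢ : x ≢ y → (x == y) ≡ false
==-≢ {x = x} {y} x≢y with x ≟ y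
... | yes x≡y = contradiction x≡y x≢y
... | no _ = refl

==-sound : (x == y) ≡ true → x ≡ y
==-sound e = toWitness (Equivalence.from T-≡ e)

fibre : Fin n → List (V n)
fibre i = (i , true) ∷ (i , false) ∷ []

∈-verts : (x : V n) → x ∈ verts n
∈-verts (i , s) = ∈-concatMap⁺ fibre (Any.map (λ { refl → ∈-fibre s }) (∈-allFin i))
  where
  ∈-fibre : ∀ s → (i , s) ∈ fibre i
  ∈-fibre true = here refl
  ∈-fibre false = there (here refl)

verts-unique : ∀ n → Unique (verts n)
verts-unique n = concat⁺ (All.map⁺ (All.universal fibre-unique (allFin n)))
                        (AllPairs.map⁺ (AllPairs.map disjoint (allFin⁺ n)))
  where
  fibre-unique : (i : Fin n) → Unique (fibre i)
  fibre-unique i = ((λ ()) ∷ []) AllPairs.∷ ([] AllPairs.∷ AllPairs.[])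
  disjoint : {i j : Fin n} → i ≢ j → Disjoint (fibre i) (fibre j)
  disjoint i≢j (here refl , here refl) = i≢j refl
  disjoint i≢j (here refl , there (here ()))
  disjoint i≢j (there (here refl) , here ())
  disjoint i≢j (there (here refl) , there (here refl)) = i≢j refl

transp-at-a : (a b : V n) → transp a b a ≡ b
transp-at-a a b rewrite ==-refl a = refl

transp-at-b : (a b : V n) → transp a b b ≡ a
transp-at-b a b with toSum (b ≟ a)
... | inj₁ refl = transp-at-a b b
... | inj₂ b≢a rewrite ==-≢ b≢a | ==-refl b = refl

transp-fix : x ≢ a → x ≢ b → transp a b x ≡ x
transp-fix x≢a x≢b rewrite ==-≢ x≢a | ==-≢ x≢b = refl

transp-involutive : (a b x : V n) → transp a b (transp a b x) ≡ x
transp-involutive a b x with toSum (x ≟ a) | toSum (x ≟ b)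
... | inj₁ refl | _ = trans (cong (transp x b) (transp-at-a x b)) (transp-at-b x b)
... | inj₂ _ | inj₁ refl = trans (cong (transp a x) (transp-at-b a x)) (transp-at-a a x)
... | inj₂ x≢a | inj₂ x≢b = trans (cong (transp a b) (transp-fix x≢a x≢b)) (transp-fix x≢a x≢b)

transp-conj : (σ : V n → V n) → (∀ z → σ (σ z) ≡ z) → (c d z : V n) →
              σ (transp c d (σ z)) ≡ transp (σ c) (σ d) z
transp-conj σ σσ c d z with toSum (z ≟ σ c) | toSum (z ≟ σ d)
... | inj₁ refl | _ = trans (cong (σ ∘ transp c d) (σσ c))
                       (trans (cong σ (transp-at-a c d)) (sym (transp-at-a (σ c) (σ d))))
... | inj₂ _ | inj₁ refl = trans (cong (σ ∘ transp c d) (σσ d))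
                          (trans (cong σ (transp-at-b c d)) (sym (transp-at-b (σ c) (σ d))))
... | inj₂ z≢σc | inj₂ z≢σd =
  trans (cong σ (transp-fix (λ e → z≢σc (trans (sym (σσ z)) (cong σ e)))
                            (λ e → z≢σd (trans (sym (σσ z)) (cong σ e)))))
        (trans (σσ z) (sym (transp-fix z≢σc z≢σd)))

transp-comm : (a b z : V n) → transp a b z ≡ transp b a z
transp-comm a b z with toSum (z ≟ a) | toSum (z ≟ b)
... | inj₁ refl | _ = trans (transp-at-a z b) (sym (transp-at-b b z))
... | inj₂ _ | inj₁ refl = trans (transp-at-b a z) (sym (transp-at-a z a))
... | inj₂ z≢a | inj₂ z≢b = trans (transp-fix z≢a z≢b) (sym (transp-fix z≢b z≢a))

transp-bar-comm : (a z : V n) → transp a (bar a) (bar z) ≡ bar (transp a (bar a) z)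
transp-bar-comm a z = begin
  transp a (bar a) (bar z)             ≡⟨ bar-involutive _ ⟨
  bar (bar (transp a (bar a) (bar z))) ≡⟨ cong bar (transp-conj bar bar-involutive a (bar a) z) ⟩
  bar (transp (bar a) (bar (bar a)) z) ≡⟨ cong (λ c → bar (transp (bar a) c z)) (bar-involutive a) ⟩
  bar (transp (bar a) a z)             ≡⟨ cong bar (transp-comm (bar a) a z) ⟩
  bar (transp a (bar a) z)             ∎
  where open ≡-Reasoning

transp-related : {R : Rel (V n) 0ℓ} → IsEquivalence R → R a b → ∀ z → R z (transp a b z)
transp-related {a = a} {b = b} {R = R} R-equiv Rab z with toSum (z ≟ a) | toSum (z ≟ b)
... | inj₁ refl | _ = subst (R z) (sym (transp-at-a z b)) Rab
... | inj₂ _ | inj₁ refl = subst (R z) (sym (transp-at-b a z)) (IsEquivalence.sym R-equiv Rab)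
... | inj₂ z≢a | inj₂ z≢b = subst (R z) (sym (transp-fix z≢a z≢b)) (IsEquivalence.refl R-equiv)

act-≡ : (ρ : V n → V n) (a b z : V n) → ρ (transp a b z) ≡ transp a b y → act a b ρ z ≡ y
act-≡ {y = y} ρ a b z e = trans (cong (transp a b) e) (transp-involutive a b y)

act-involutive : (a b : V n) → act a b (act a b ρ) ≗ ρ
act-involutive {ρ = ρ} a b z =
  trans (transp-involutive a b _) (cong ρ (transp-involutive a b z))

act-isFPFInvolution : (a b : V n) → IsFPFInvolution ρ → IsFPFInvolution (act a b ρ)
act-isFPFInvolution {ρ = ρ} a b (ρρ , ρ-fpf) = involutive , fixed-point-free
  where
  involutive : ∀ z → act a b ρ (act a b ρ z) ≡ z
  involutive z = act-≡ ρ a b (act a b ρ z)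
    (trans (cong ρ (transp-involutive a b (ρ (transp a b z)))) (ρρ (transp a b z)))
  fixed-point-free : ∀ z → act a b ρ z ≢ z
  fixed-point-free z e = ρ-fpf (transp a b z)
    (trans (sym (transp-involutive a b (ρ (transp a b z)))) (cong (transp a b) e))

-- The graph ρ ∪ τ and the closure computed by comp

Edge : (V n → V n) → Rel (V n) 0ℓ
Edge ρ x y = y ≡ ρ x ⊎ y ≡ bar x

Connected : (V n → V n) → Rel (V n) 0ℓ
Connected ρ = EqClosure (Edge ρ)

ρ-edge : (x : V n) → Connected ρ x (ρ x)
ρ-edge x = fwd (inj₁ refl) ◅ ε

τ-edge : (x : V n) → Connected ρ x (bar x)
τ-edge x = fwd (inj₂ refl) ◅ ε

Connected-sym : Connected ρ x y → Connected ρ y x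
Connected-sym = EqClosure.symmetric _

Connected-resp-≗ : {ρ ρ′ : V n → V n} → ρ ≗ ρ′ → Connected ρ x y → Connected ρ′ x y
Connected-resp-≗ ρ≗ρ′ = EqClosure.map λ
  { (inj₁ y≡ρx) → inj₁ (trans y≡ρx (ρ≗ρ′ _))
  ; (inj₂ y≡x̄) → inj₂ y≡x̄ }

Connected-closed : (∀ z → ρ (ρ z) ≡ z) → (P : Pred (V n) 0ℓ) →
                   (∀ {z} → P z → P (ρ z)) → (∀ {z} → P z → P (bar z)) →
                   Connected ρ x y → P x → P y
Connected-closed {ρ = ρ} ρρ P Pρ Pbar c = Equivalence.to (EqClosure.gfold ⇔-isEquivalence P edge c)
  where
  edge : ∀ {x y} → Edge ρ x y → P x ⇔ P y
  edge (inj₁ refl) = mk⇔ Pρ (λ p → subst P (ρρ _) (Pρ p))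
  edge (inj₂ refl) = mk⇔ Pbar (λ p → subst P (bar-involutive _) (Pbar p))

adj-sound : T (adj ρ x y) → SymClosure (Edge ρ) x y
adj-sound {ρ = ρ} {x} {y} t with Equivalence.to (T-∨ {y == ρ x}) t
... | inj₁ y≡ρx = fwd (inj₁ (toWitness y≡ρx))
... | inj₂ t′ with Equivalence.to (T-∨ {x == ρ y}) t′
... | inj₁ x≡ρy = bwd (inj₁ (toWitness x≡ρy))
... | inj₂ t″ with Equivalence.to (T-∨ {y == bar x}) t″
... | inj₁ y≡x̄ = fwd (inj₂ (toWitness y≡x̄))
... | inj₂ x≡ȳ = bwd (inj₂ (toWitness x≡ȳ))

adj-complete : Edge ρ x y → T (adj ρ x y)
adj-complete {ρ = ρ} {x} {y} (inj₁ y≡ρx) = Equivalence.from (T-∨ {y == ρ x}) (inj₁ (fromWitness y≡ρx))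
adj-complete {ρ = ρ} {x} {y} (inj₂ y≡x̄) =
  Equivalence.from (T-∨ {y == ρ x}) (inj₂ (Equivalence.from (T-∨ {x == ρ y})
    (inj₂ (Equivalence.from (T-∨ {y == bar x}) (inj₁ (fromWitness y≡x̄))))))

near? : (ρ : V n → V n) (S : List (V n)) → Decidable (λ y → any (λ s → (y == s) ∨ adj ρ s y) S ≡ true)
near? ρ S y = any (λ s → (y == s) ∨ adj ρ s y) S ≟ᵇ true

∈-step⁻ : {S : List (V n)} → y ∈ step ρ S → ∃[ s ] s ∈ S × (y ≡ s ⊎ SymClosure (Edge ρ) s y)
∈-step⁻ {n} {y} {ρ} {S} y∈
  with find (any⁻ _ S (Equivalence.from T-≡ (proj₂ (∈-filter⁻ (near? ρ S) {xs = verts n} y∈))))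
... | s , s∈S , t with Equivalence.to (T-∨ {y == s}) t
... | inj₁ y≡s = s , s∈S , inj₁ (toWitness y≡s)
... | inj₂ s-y = s , s∈S , inj₂ (adj-sound s-y)

∈-step⁺ : {S : List (V n)} {s : V n} → s ∈ S → y ≡ s ⊎ Edge ρ s y → y ∈ step ρ S
∈-step⁺ {n} {y} {ρ} {S} {s} s∈S y-s =
  ∈-filter⁺ (near? ρ S) (∈-verts y)
    (Equivalence.to T-≡ (any⁺ _ (lose s∈S (Equivalence.from (T-∨ {y == s}) (close y-s)))))
  where
  close : y ≡ s ⊎ Edge ρ s y → T (y == s) ⊎ T (adj ρ s y)
  close = [ inj₁ ∘ fromWitness , inj₂ ∘ adj-complete ]′

reach : (V n → V n) → V n → ℕ → List (V n)
reach ρ x k = iter k (step ρ) (x ∷ [])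

reach-sound : ∀ k → y ∈ reach ρ x k → Connected ρ x y
reach-sound zero (here refl) = ε
reach-sound (suc k) y∈ with ∈-step⁻ y∈
... | s , s∈ , inj₁ refl = reach-sound k s∈
... | s , s∈ , inj₂ s-y = reach-sound k s∈ ◅◅ (s-y ◅ ε)

reach-edge : ∀ k → y ∈ reach ρ x k → Edge ρ y z → z ∈ reach ρ x (suc k)
reach-edge k y∈ e = ∈-step⁺ y∈ (inj₂ e)

reach-mono : ∀ {k l} → k ≤′ l → y ∈ reach ρ x k → y ∈ reach ρ x l
reach-mono ≤′-refl y∈ = y∈
reach-mono (≤′-step k≤′l) y∈ = ∈-step⁺ (reach-mono k≤′l y∈) (inj₁ refl)

∈-comp⁻ : y ∈ comp ρ x → Connected ρ x y
∈-comp⁻ {n} = reach-sound (2 * n)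

-- The cycle through a vertex

module Rotation {ρ : V n → V n} (ρ-fpf : IsFPFInvolution ρ) where

  private
    ρρ = proj₁ ρ-fpf

  π : V n → V n
  π = ρ ∘ bar

  π-injective : π y ≡ π z → y ≡ z
  π-injective {y = y} {z} e = bar-injective (trans (sym (ρρ (bar y))) (trans (cong ρ e) (ρρ (bar z))))

  π^-injective : ∀ d → iter d π y ≡ iter d π z → y ≡ z
  π^-injective zero e = e
  π^-injective (suc d) e = π^-injective d (π-injective e)

  π-bar-π : ∀ y → π (bar (π y)) ≡ bar y
  π-bar-π y = trans (cong ρ (bar-involutive (ρ (bar y)))) (ρρ (bar y))

  π^-bar-π^ : ∀ d y → iter d π (bar (iter d π y)) ≡ bar y
  π^-bar-π^ zero y = refl
  π^-bar-π^ (suc d) y = trans (sym (iter-comm π d _))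
    (trans (cong (iter d π) (π-bar-π (iter d π y))) (π^-bar-π^ d y))

  π^≢bar : ∀ e y → iter e π y ≢ bar y
  π^≢bar zero y e = bar-≢ y (sym e)
  π^≢bar (suc zero) y e = proj₂ ρ-fpf (bar y) e
  π^≢bar (suc (suc e)) y eq = π^≢bar e (π y)
    (trans (iter-comm π e y) (π-injective (trans eq (sym (π-bar-π y)))))

-- u k = (ρ ∘ τ)ᵏ x and v k = τ (u k): the cycle of ρ ∪ τ through x reads
-- u 0, v 0, u 1, v 1, … with τ-edges u k — v k and ρ-edges v k — u (suc k).
module Cycle {ρ : V n → V n} (ρ-fpf : IsFPFInvolution ρ) (x : V n) where

  open Rotation ρ-fpf

  private
    ρρ = proj₁ ρ-fpf

  u : ℕ → V n
  u k = iter k π x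

  v : ℕ → V n
  v k = bar (u k)

  u-+ : ∀ d k → u (d + k) ≡ iter d π (u k)
  u-+ d k = iter-+ π d k x

  ρ-u : ∀ k → ρ (u (suc k)) ≡ v k
  ρ-u k = ρρ (v k)

  u≢v : ∀ k l → u k ≢ v l
  u≢v k l uk≡vl with ≤-total l k
  ... | inj₁ l≤k = let e , l+e≡k = m≤n⇒∃[o]m+o≡n l≤k in
    π^≢bar e (u l) (trans (sym (u-+ e l)) (trans (cong u (trans (+-comm e l) l+e≡k)) uk≡vl))
  ... | inj₂ k≤l = let e , k+e≡l = m≤n⇒∃[o]m+o≡n k≤l in
    π^≢bar e (u k) (trans (sym (u-+ e k)) (trans (cong u (trans (+-comm e k) k+e≡l))
      (trans (sym (bar-involutive (u l))) (cong bar (sym uk≡vl)))))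

  -- pigeonhole on the fibres of u 0, …, u n; two of them in one fibre coincide since u k ≢ v l
  u-returns : ∃[ p ] 0 < p × p ≤ n × u p ≡ x
  u-returns with pigeonhole (n<1+n n) (proj₁ ∘ u ∘ toℕ)
  ... | k₁ , k₂ , k₁<k₂ , same-index with same-fibre same-index
  ... | inj₂ uk₁≡vk₂ = contradiction uk₁≡vk₂ (u≢v (toℕ k₁) (toℕ k₂))
  ... | inj₁ uk₁≡uk₂ = let d , k₁+d≡k₂ = m≤n⇒∃[o]m+o≡n k₁<k₂ in
    suc d , s≤s z≤n , ≤-trans (s≤s (m≤n+m d (toℕ k₁))) (≤-trans (≤-reflexive k₁+d≡k₂) (toℕ≤pred[n] k₂)) ,
    π^-injective (toℕ k₁)
      (trans (sym (u-+ (toℕ k₁) (suc d)))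
             (trans (cong u (trans (+-suc (toℕ k₁) d) k₁+d≡k₂)) (sym uk₁≡uk₂)))

  private
    first-return : ∃[ l ] l < n × u (suc l) ≡ x × (∀ {k} → k < l → u (suc k) ≢ x)
    first-return with u-returns
    ... | suc p , _ , p≤n , up≡x with least (λ k → u (suc k) ≟ x) up≡x
    ... | l , l≤p , ul≡x , below = l , ≤-trans (s≤s l≤p) p≤n , ul≡x , below

  last : ℕ
  last = proj₁ first-return

  last<n : last < n
  last<n = proj₁ (proj₂ first-return)

  u-last : u (suc last) ≡ x
  u-last = proj₁ (proj₂ (proj₂ first-return))

  u-before-last : ∀ {k} → k < last → u (suc k) ≢ x
  u-before-last = proj₂ (proj₂ (proj₂ first-return))

  ρ-x : ρ x ≡ v last
  ρ-x = trans (cong ρ (sym u-last)) (ρ-u last)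

  OnCycle : Pred (V n) 0ℓ
  OnCycle y = ∃[ k ] k ≤ last × (y ≡ u k ⊎ y ≡ v k)

  OnCycle-ρ : OnCycle y → OnCycle (ρ y)
  OnCycle-ρ (zero , _ , inj₁ refl) = last , ≤-refl , inj₂ ρ-x
  OnCycle-ρ (suc k , k<last , inj₁ refl) = k , <⇒≤ k<last , inj₂ (ρ-u k)
  OnCycle-ρ (k , k≤last , inj₂ refl) with m≤n⇒m<n∨m≡n k≤last
  ... | inj₁ k<last = suc k , k<last , inj₁ refl
  ... | inj₂ refl = zero , z≤n , inj₁ u-last

  OnCycle-bar : OnCycle y → OnCycle (bar y)
  OnCycle-bar (k , k≤last , inj₁ refl) = k , k≤last , inj₂ refl
  OnCycle-bar (k , k≤last , inj₂ refl) = k , k≤last , inj₁ (bar-involutive (u k))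

  on-cycle : Connected ρ x y → OnCycle y
  on-cycle c = Connected-closed ρρ OnCycle OnCycle-ρ OnCycle-bar c (zero , z≤n , inj₁ refl)

  u∈reach : ∀ k → u k ∈ reach ρ x (k + k)
  v∈reach : ∀ k → v k ∈ reach ρ x (suc (k + k))
  u∈reach zero = here refl
  u∈reach (suc k) = subst (λ l → u (suc k) ∈ reach ρ x l) (cong suc (sym (+-suc k k)))
                          (reach-edge (suc (k + k)) (v∈reach k) (inj₁ refl))
  v∈reach k = reach-edge (k + k) (u∈reach k) (inj₂ refl)

  k-bound : ∀ {k} → k ≤ last → suc (k + k) ≤ 2 * n
  k-bound {k} k≤last = subst (suc (k + k) ≤_) (cong (n +_) (sym (+-identityʳ n)))
    (+-mono-≤ k<n (<⇒≤ k<n))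
    where k<n = ≤-<-trans k≤last last<n

  ∈-comp⁺ : Connected ρ x y → y ∈ comp ρ x
  ∈-comp⁺ c with on-cycle c
  ... | k , k≤last , inj₁ refl = reach-mono (≤⇒≤′ (<⇒≤ (k-bound k≤last))) (u∈reach k)
  ... | k , k≤last , inj₂ refl = reach-mono (≤⇒≤′ (k-bound k≤last)) (v∈reach k)

  u-connected : ∀ k → Connected ρ x (u k)
  u-connected k = reach-sound (k + k) (u∈reach k)

  v-connected : ∀ k → Connected ρ x (v k)
  v-connected k = reach-sound (suc (k + k)) (v∈reach k)

  -- On the cycle, (a x).ρ only replaces the edge x — ρ x by a — ρ x, so the rest of
  -- the cycle still connects x to ρ x = v last.
  joins : ¬ Connected ρ a x → Connected (act a x ρ) a x
  joins {a = a} a≁x =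
    subst (Connected ρ′ a) (trans ρ′-a ρ-x) (ρ-edge a) ◅◅ Connected-sym (to-v last ≤-refl)
    where
    ρ′ = act a x ρ
    off-a : Connected ρ x y → y ≢ a
    off-a c refl = a≁x (Connected-sym c)
    ρ′-v : ∀ {k} → k < last → ρ′ (v k) ≡ u (suc k)
    ρ′-v {k} k<last = act-≡ ρ a x (v k)
      (trans (cong ρ (transp-fix (off-a (v-connected k)) (λ e → u≢v 0 k (sym e))))
             (sym (transp-fix (off-a (u-connected (suc k))) (u-before-last k<last))))
    ρ′-a : ρ′ a ≡ ρ x
    ρ′-a = act-≡ ρ a x a (trans (cong ρ (transp-at-a a x))
      (sym (transp-fix (off-a (ρ-edge x)) (proj₂ ρ-fpf x))))
    to-v : ∀ k → k ≤ last → Connected ρ′ x (v k)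
    to-v zero _ = τ-edge x
    to-v (suc k) k<last = to-v k (<⇒≤ k<last)
      ◅◅ subst (Connected ρ′ (v k)) (ρ′-v k<last) (ρ-edge (v k)) ◅◅ τ-edge (u (suc k))

  -- If j = u (suc t) is the first visit of j, then ρ′ = (x j).ρ closes the arc
  -- u 0, v 0, …, u t, v t into a cycle of its own (ρ′ x = v t, ρ′ (v t) = x).
  separates-at-first-visit : ∀ {j t} → u (suc t) ≡ j → (∀ {k} → k ≤ t → u k ≢ j) →
                             ¬ Connected (act x j ρ) x j
  separates-at-first-visit {j} {t} u-t≡j not-before c =
    j∉Arc (Connected-closed (proj₁ (act-isFPFInvolution x j ρ-fpf)) Arc Arc-ρ′ Arc-bar c
                            (zero , z≤n , inj₁ refl))
    where
    ρ′ = act x j ρ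
    Arc : Pred (V n) 0ℓ
    Arc y = ∃[ k ] k ≤ t × (y ≡ u k ⊎ y ≡ v k)
    u-inner-≢x : ∀ {k} → 0 < k → k ≤ t → u k ≢ x
    u-inner-≢x {suc k} _ k≤t uk≡x = let e , k+e≡t = m≤n⇒∃[o]m+o≡n k≤t in
      not-before (≤-trans (s≤s (m≤n+m e k)) (≤-reflexive k+e≡t))
        (trans (cong (iter (suc e) π) (sym uk≡x))
          (trans (sym (u-+ (suc e) (suc k)))
                 (trans (cong (u ∘ suc) (trans (+-comm e (suc k)) k+e≡t)) u-t≡j)))
    fix-u : ∀ {k} → 0 < k → k ≤ t → transp x j (u k) ≡ u k
    fix-u 0<k k≤t = transp-fix (u-inner-≢x 0<k k≤t) (not-before k≤t)
    v≢j : ∀ k → v k ≢ j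
    v≢j k vk≡j = u≢v (suc t) k (trans u-t≡j (sym vk≡j))
    fix-v : ∀ k → transp x j (v k) ≡ v k
    fix-v k = transp-fix (λ e → u≢v 0 k (sym e)) (v≢j k)
    Arc-ρ′ : Arc y → Arc (ρ′ y)
    Arc-ρ′ (zero , _ , inj₁ refl) = t , ≤-refl , inj₂ (act-≡ ρ x j x
      (trans (cong ρ (trans (transp-at-a x j) (sym u-t≡j))) (trans (ρ-u t) (sym (fix-v t)))))
    Arc-ρ′ (suc k , k<t , inj₁ refl) = k , <⇒≤ k<t , inj₂ (act-≡ ρ x j (u (suc k))
      (trans (cong ρ (fix-u (s≤s z≤n) k<t)) (trans (ρ-u k) (sym (fix-v k)))))
    Arc-ρ′ (k , k≤t , inj₂ refl) with m≤n⇒m<n∨m≡n k≤t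
    ... | inj₁ k<t = suc k , k<t , inj₁ (act-≡ ρ x j (v k)
      (trans (cong ρ (fix-v k)) (sym (fix-u (s≤s z≤n) k<t))))
    ... | inj₂ refl = zero , z≤n , inj₁ (act-≡ ρ x j (v k)
      (trans (cong ρ (fix-v k)) (trans u-t≡j (sym (transp-at-a x j)))))
    Arc-bar : Arc y → Arc (bar y)
    Arc-bar (k , k≤t , inj₁ refl) = k , k≤t , inj₂ refl
    Arc-bar (k , k≤t , inj₂ refl) = k , k≤t , inj₁ (bar-involutive (u k))
    j∉Arc : ¬ Arc j
    j∉Arc (k , k≤t , inj₁ j≡uk) = not-before k≤t (sym j≡uk)
    j∉Arc (k , k≤t , inj₂ j≡vk) = v≢j k (sym j≡vk)

  separates : ∀ {j s} → x ≢ j → u s ≡ j → ¬ Connected (act x j ρ) x j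
  separates {j} {s} x≢j us≡j with least (λ k → u k ≟ j) {s} us≡j
  ... | zero , _ , u0≡j , _ = contradiction u0≡j x≢j
  ... | suc t , _ , ut≡j , below = separates-at-first-visit ut≡j (λ k≤t → below (s≤s k≤t))

  -- the walk from τ x runs around the cycle in the opposite direction
  v-from-bar : ∀ {k} → k ≤ last → ∃[ d ] iter d π (bar x) ≡ v k
  v-from-bar {k} k≤last = let d , k+d≡ = m≤n⇒∃[o]m+o≡n (≤-trans k≤last (n≤1+n last)) in
    d , trans (cong (iter d π ∘ bar)
                    (trans (sym u-last) (trans (cong u (trans (sym k+d≡) (+-comm k d))) (u-+ d k))))
              (π^-bar-π^ d (u k))

Connected? : IsFPFInvolution ρ → ∀ x y → Dec (Connected ρ x y)
Connected? {ρ = ρ} ρ-fpf x y = map′ ∈-comp⁻ (Cycle.∈-comp⁺ ρ-fpf x) (any? (y ≟_) (comp ρ x))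

step≡filter : {S : List (V n)} {P : Pred (V n) 0ℓ} (P? : Decidable P) →
              (∀ {y} → y ∈ step ρ S ⇔ P y) → step ρ S ≡ filter P? (verts n)
step≡filter {n} {ρ} {S} P? ∈⇔P = filter-≐ (near? ρ S) P?
  ((λ p → Equivalence.to ∈⇔P (∈-filter⁺ (near? ρ S) (∈-verts _) p)) ,
   (λ p → proj₂ (∈-filter⁻ (near? ρ S) {xs = verts n} (Equivalence.from ∈⇔P p)))) (verts n)

comp≡filter : (ρ-fpf : IsFPFInvolution ρ) (x : V n) → comp ρ x ≡ filter (Connected? ρ-fpf x) (verts n)
comp≡filter {n = zero} ρ-fpf (() , _)
comp≡filter {n = suc m} {ρ} ρ-fpf x = step≡filter {S = reach ρ x (pred (2 * suc m))} (Connected? ρ-fpf x)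
  (mk⇔ ∈-comp⁻ (Cycle.∈-comp⁺ ρ-fpf x))

comp-cong : {ρ₁ ρ₂ : V n → V n} {x₁ x₂ : V n} →
            (ρ₁-fpf : IsFPFInvolution ρ₁) (ρ₂-fpf : IsFPFInvolution ρ₂) →
            (∀ {y} → Connected ρ₁ x₁ y ⇔ Connected ρ₂ x₂ y) → comp ρ₁ x₁ ≡ comp ρ₂ x₂
comp-cong {n} {x₁ = x₁} {x₂} ρ₁-fpf ρ₂-fpf c⇔c = begin
  _                                       ≡⟨ comp≡filter ρ₁-fpf x₁ ⟩
  filter (Connected? ρ₁-fpf x₁) (verts n) ≡⟨ filter-≐ _ _ (to c⇔c , from c⇔c) (verts n) ⟩
  filter (Connected? ρ₂-fpf x₂) (verts n) ≡⟨ comp≡filter ρ₂-fpf x₂ ⟨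
  _                                       ∎
  where
  open ≡-Reasoning
  open Equivalence

comp-resp : IsFPFInvolution ρ → Connected ρ x y → comp ρ x ≡ comp ρ y
comp-resp ρ-fpf x∼y = comp-cong ρ-fpf ρ-fpf (mk⇔ (Connected-sym x∼y ◅◅_) (x∼y ◅◅_))

leader : IsFPFInvolution ρ → ∀ x → ∃[ m ] head (comp ρ x) ≡ just m × Connected ρ x m
leader ρ-fpf x with head-∈ (Cycle.∈-comp⁺ ρ-fpf x ε)
... | m , h , m∈ = m , h , ∈-comp⁻ m∈

isRep⇔head : (ρ : V n → V n) (x : V n) → isRep ρ x ≡ true ⇔ head (comp ρ x) ≡ just x
isRep⇔head ρ x with comp ρ x
... | [] = mk⇔ (λ ()) (λ ())
... | y ∷ _ = mk⇔ (cong just ∘ ==-sound) (λ { refl → ==-refl y })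

isRep-cong : {ρ₁ ρ₂ : V n → V n} → head (comp ρ₁ x) ≡ head (comp ρ₂ x) →
             isRep ρ₁ x ≡ true ⇔ isRep ρ₂ x ≡ true
isRep-cong {x = x} {ρ₁} {ρ₂} h = mk⇔
  (λ r → Equivalence.from (isRep⇔head ρ₂ x) (trans (sym h) (Equivalence.to (isRep⇔head ρ₁ x) r)))
  (λ r → Equivalence.from (isRep⇔head ρ₁ x) (trans h (Equivalence.to (isRep⇔head ρ₂ x) r)))

IsRep? : (ρ : V n → V n) → Decidable (λ x → isRep ρ x ≡ true)
IsRep? ρ x = isRep ρ x ≟ᵇ true

type-cong : {ρ₁ ρ₂ : V n → V n} → IsFPFInvolution ρ₁ → IsFPFInvolution ρ₂ →
            (∀ {x y} → Connected ρ₁ x y ⇔ Connected ρ₂ x y) → type ρ₁ ≡ type ρ₂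
type-cong {n} {ρ₁} {ρ₂} ρ₁-fpf ρ₂-fpf c⇔c =
  trans (cong (λ rs → reverse (sort (map (λ x → length (comp ρ₁ x) / 2) rs))) reps-eq)
        (cong (reverse ∘ sort) (map-cong (λ x → cong (λ c → length c / 2) (comp-eq x)) (reps ρ₂)))
  where
  comp-eq : ∀ x → comp ρ₁ x ≡ comp ρ₂ x
  comp-eq x = comp-cong ρ₁-fpf ρ₂-fpf c⇔c
  rep⇔rep : ∀ {x} → isRep ρ₁ x ≡ true ⇔ isRep ρ₂ x ≡ true
  rep⇔rep {x} = isRep-cong (cong head (comp-eq x))
  reps-eq : reps ρ₁ ≡ reps ρ₂
  reps-eq = filter-≐ (IsRep? ρ₁) (IsRep? ρ₂)
                     (Equivalence.to rep⇔rep , Equivalence.from rep⇔rep) (verts n)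

length-type : (ρ : V n → V n) → length (type ρ) ≡ length (reps ρ)
length-type ρ = begin
  length (reverse (sort sizes)) ≡⟨ length-reverse (sort sizes) ⟩
  length (sort sizes)           ≡⟨ ↭-length (sort-↭ sizes) ⟩
  length sizes                  ≡⟨ length-map _ (reps ρ) ⟩
  length (reps ρ)               ∎
  where
  open ≡-Reasoning
  sizes = map (λ x → length (comp ρ x) / 2) (reps ρ)

-- Conjugating by a transposition

Connected-act⊆ : {R : Rel (V n) 0ℓ} → IsEquivalence R → Edge ρ ⇒ R → R a b → Connected (act a b ρ) ⇒ R
Connected-act⊆ {ρ = ρ} {a = a} {b = b} {R = R} R-equiv edge Rab = EqClosure.fold R-equiv edge′
  where
  open IsEquivalence R-equiv using () renaming (trans to R-trans)
  edge′ : Edge (act a b ρ) ⇒ R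
  edge′ {x} (inj₁ refl) = R-trans (transp-related R-equiv Rab x)
    (R-trans (edge (inj₁ refl)) (transp-related R-equiv Rab (ρ (transp a b x))))
  edge′ (inj₂ refl) = edge (inj₂ refl)

Connected-act⇒Connected : Connected ρ a b → Connected (act a b ρ) x y → Connected ρ x y
Connected-act⇒Connected ab = Connected-act⊆ (EqClosure.isEquivalence _) (λ e → fwd e ◅ ε) ab

Touches : (V n → V n) → V n → V n → Pred (V n) 0ℓ
Touches ρ a b z = Connected ρ a z ⊎ Connected ρ b z

Merged : (V n → V n) → V n → V n → Rel (V n) 0ℓ
Merged ρ a b x y = Connected ρ x y ⊎ (Touches ρ a b x × Touches ρ a b y)

Merged-swap : Merged ρ a b x y → Merged ρ b a x y
Merged-swap = Sum.map₂ (Product.map Sum.swap Sum.swap)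

Touches-resp : Connected ρ x y → Touches ρ a b x → Touches ρ a b y
Touches-resp c (inj₁ ax) = inj₁ (ax ◅◅ c)
Touches-resp c (inj₂ bx) = inj₂ (bx ◅◅ c)

Merged-resp : Connected ρ a a′ → Merged ρ a b x y → Merged ρ a′ b x y
Merged-resp {ρ = ρ} {a} {a′} {b} a∼a′ = Sum.map₂ (Product.map shift shift)
  where
  shift : Touches ρ a b z → Touches ρ a′ b z
  shift = Sum.map₁ (Connected-sym a∼a′ ◅◅_)

Merged-isEquivalence : IsEquivalence (Merged ρ a b)
Merged-isEquivalence = record { refl = inj₁ ε ; sym = sym′ ; trans = trans′ }
  where
  sym′ : Merged ρ a b x y → Merged ρ a b y x
  sym′ (inj₁ c) = inj₁ (Connected-sym c)
  sym′ (inj₂ (tx , ty)) = inj₂ (ty , tx)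
  trans′ : Merged ρ a b x y → Merged ρ a b y z → Merged ρ a b x z
  trans′ (inj₁ c) (inj₁ d) = inj₁ (c ◅◅ d)
  trans′ (inj₁ c) (inj₂ (ty , tz)) = inj₂ (Touches-resp (Connected-sym c) ty , tz)
  trans′ (inj₂ (tx , ty)) (inj₁ d) = inj₂ (tx , Touches-resp d ty)
  trans′ (inj₂ (tx , _)) (inj₂ (_ , tz)) = inj₂ (tx , tz)

Connected-act⇔Merged : IsFPFInvolution ρ → ¬ Connected ρ a b →
                       Connected (act a b ρ) x y ⇔ Merged ρ a b x y
Connected-act⇔Merged {ρ = ρ} {a = a} {b = b} ρ-fpf a≁b =
  mk⇔ (Connected-act⊆ Merged-isEquivalence (λ e → inj₁ (fwd e ◅ ε)) (inj₂ (inj₁ ε , inj₂ ε))) from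
  where
  ρ′ = act a b ρ
  a∼′b : Connected ρ′ a b
  a∼′b = Cycle.joins ρ-fpf b a≁b
  lift : Connected ρ x y → Connected ρ′ x y
  lift c = Connected-act⇒Connected a∼′b (Connected-resp-≗ (sym ∘ act-involutive a b) c)
  from-a : Touches ρ a b z → Connected ρ′ a z
  from-a (inj₁ az) = lift az
  from-a (inj₂ bz) = a∼′b ◅◅ lift bz
  from : Merged ρ a b x y → Connected ρ′ x y
  from (inj₁ c) = lift c
  from (inj₂ (tx , ty)) = Connected-sym (from-a tx) ◅◅ from-a ty

module _ {ρ ρ′ : V n → V n} (ρ-fpf : IsFPFInvolution ρ) (ρ′-fpf : IsFPFInvolution ρ′) where

  private
    -- If the merged class keeps the leader (first vertex in verts order) of a's class,
    -- exactly the leader of b's class stops being a representative.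
    reps-merged-ordered : ¬ Connected ρ a b → (∀ {x y} → Connected ρ′ x y ⇔ Merged ρ a b x y) →
                          head (comp ρ′ a) ≡ head (comp ρ a) → length (reps ρ) ≡ suc (length (reps ρ′))
    reps-merged-ordered {a = a} {b} a≁b merged lead =
      length-filter-except (IsRep? ρ) (IsRep? ρ′) (verts-unique n) (∈-verts mB) rep-mB ¬rep′-mB agree
      where
      open Equivalence
      mA mB : V n
      mA = proj₁ (leader ρ-fpf a)
      mB = proj₁ (leader ρ-fpf b)
      a∼mA : Connected ρ a mA
      a∼mA = proj₂ (proj₂ (leader ρ-fpf a))
      b∼mB : Connected ρ b mB
      b∼mB = proj₂ (proj₂ (leader ρ-fpf b))
      head-a : Connected ρ a z → head (comp ρ z) ≡ just mA
      head-a a∼z = trans (cong head (comp-resp ρ-fpf (Connected-sym a∼z))) (proj₁ (proj₂ (leader ρ-fpf a)))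
      head-b : Connected ρ b z → head (comp ρ z) ≡ just mB
      head-b b∼z = trans (cong head (comp-resp ρ-fpf (Connected-sym b∼z))) (proj₁ (proj₂ (leader ρ-fpf b)))
      head′-touching : Touches ρ a b z → head (comp ρ′ z) ≡ just mA
      head′-touching t =
        trans (cong head (comp-resp ρ′-fpf (from merged (inj₂ (t , inj₁ ε))))) (trans lead (head-a ε))
      rep-mB : isRep ρ mB ≡ true
      rep-mB = from (isRep⇔head ρ mB) (head-b b∼mB)
      ¬rep′-mB : isRep ρ′ mB ≢ true
      ¬rep′-mB r = a≁b (subst (Connected ρ a) mA≡mB a∼mA ◅◅ Connected-sym b∼mB)
        where
        mA≡mB : mA ≡ mB
        mA≡mB = just-injective (trans (sym (head′-touching (inj₂ b∼mB))) (to (isRep⇔head ρ′ mB) r))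
      agree : x ≢ mB → isRep ρ x ≡ true ⇔ isRep ρ′ x ≡ true
      agree {x} x≢mB with Connected? ρ-fpf a x | Connected? ρ-fpf b x
      ... | yes a∼x | _ = isRep-cong (trans (head-a a∼x) (sym (head′-touching (inj₁ a∼x))))
      ... | no a≁x | yes b∼x = mk⇔
        (λ r → ⊥-elim (x≢mB (just-injective (trans (sym (to (isRep⇔head ρ x) r)) (head-b b∼x)))))
        (λ r → ⊥-elim (a≁x (subst (Connected ρ a)
          (just-injective (trans (sym (head′-touching (inj₂ b∼x))) (to (isRep⇔head ρ′ x) r))) a∼mA)))
      ... | no a≁x | no b≁x = isRep-cong (cong head (comp-cong ρ-fpf ρ′-fpf (mk⇔
        (λ c → from merged (inj₁ c))
        (λ c → [ id , (λ (tx , _) → contradiction tx [ a≁x , b≁x ]′) ]′ (to merged c)))))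

  reps-merged : ¬ Connected ρ a b → (∀ {x y} → Connected ρ′ x y ⇔ Merged ρ a b x y) →
                length (reps ρ) ≡ suc (length (reps ρ′))
  reps-merged {a = a} {b} a≁b merged =
    [ (λ h → reps-merged-ordered a≁b merged (trans (head-filter h) (sym (head-comp ρ-fpf a))))
    , (λ h → reps-merged-ordered (a≁b ∘ Connected-sym) merged-swapped
               (trans (cong head (comp-resp ρ′-fpf (Connected-sym a∼′b)))
                      (trans (head-filter h) (sym (head-comp ρ-fpf b)))))
    ]′ (head-filter-⊎ (Connected? ρ-fpf a) (Connected? ρ-fpf b) (Connected? ρ′-fpf a)
                      a∼′⇔touches (verts n))
    where
    open Equivalence
    head-comp : {ρ : V n → V n} (ρ-fpf : IsFPFInvolution ρ) (x : V n) →
                head (comp ρ x) ≡ head (filter (Connected? ρ-fpf x) (verts n))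
    head-comp ρ-fpf x = cong head (comp≡filter ρ-fpf x)
    head-filter : ∀ {m} → head (filter (Connected? ρ′-fpf a) (verts n)) ≡ m → head (comp ρ′ a) ≡ m
    head-filter = trans (head-comp ρ′-fpf a)
    a∼′⇔touches : Connected ρ′ a y ⇔ Touches ρ a b y
    a∼′⇔touches = mk⇔ ([ inj₁ , proj₂ ]′ ∘ to merged) (λ t → from merged (inj₂ (inj₁ ε , t)))
    a∼′b : Connected ρ′ a b
    a∼′b = from merged (inj₂ (inj₁ ε , inj₂ ε))
    merged-swapped : Connected ρ′ x y ⇔ Merged ρ b a x y
    merged-swapped = mk⇔ (Merged-swap ∘ to merged) (from merged ∘ Merged-swap)

-- Joins, cuts and twists

type-act-involutive : (a b : V n) → IsFPFInvolution ρ → type (act a b (act a b ρ)) ≡ type ρ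
type-act-involutive {ρ = ρ} a b ρ-fpf =
  type-cong (act-isFPFInvolution {ρ = act a b ρ} a b (act-isFPFInvolution a b ρ-fpf)) ρ-fpf
  (mk⇔ (Connected-resp-≗ (act-involutive a b)) (Connected-resp-≗ (sym ∘ act-involutive a b)))

makes-join : IsFPFInvolution ρ → ¬ Connected ρ a b → MakesJoin ρ a b
makes-join {ρ = ρ} {a} {b} ρ-fpf a≁b = begin
  suc (length (type (act a b ρ))) ≡⟨ cong suc (length-type (act a b ρ)) ⟩
  suc (length (reps (act a b ρ))) ≡⟨ reps-merged ρ-fpf (act-isFPFInvolution a b ρ-fpf) a≁b
                                       (Connected-act⇔Merged ρ-fpf a≁b) ⟨
  length (reps ρ)                 ≡⟨ length-type ρ ⟨
  length (type ρ)                 ∎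
  where open ≡-Reasoning

makes-cut : IsFPFInvolution ρ → ¬ Connected (act a b ρ) a b → MakesCut ρ a b
makes-cut {ρ = ρ} {a} {b} ρ-fpf a≁′b =
  trans (sym (makes-join (act-isFPFInvolution a b ρ-fpf) a≁′b))
        (cong (suc ∘ length) (type-act-involutive {ρ = ρ} a b ρ-fpf))

makes-twist : IsFPFInvolution ρ → Connected ρ a b → Connected (act a b ρ) a b → MakesTwist ρ a b
makes-twist {ρ = ρ} {a} {b} ρ-fpf a∼b a∼′b = type-cong (act-isFPFInvolution a b ρ-fpf) ρ-fpf
  (mk⇔ (Connected-act⇒Connected a∼b)
       (Connected-act⇒Connected a∼′b ∘ Connected-resp-≗ (sym ∘ act-involutive a b)))

module _ (ρ : V n → V n) (a b : V n) where

  join⇒¬cut : MakesJoin ρ a b → ¬ MakesCut ρ a b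
  join⇒¬cut join cut = <-asym (≤-reflexive join) (≤-reflexive (sym cut))

  join⇒¬twist : MakesJoin ρ a b → ¬ MakesTwist ρ a b
  join⇒¬twist join twist = <-irrefl (cong length twist) (≤-reflexive join)

  cut⇒¬twist : MakesCut ρ a b → ¬ MakesTwist ρ a b
  cut⇒¬twist cut twist = <-irrefl (sym (cong length twist)) (≤-reflexive (sym cut))

joins-agree : IsFPFInvolution ρ → Connected ρ a a′ → ¬ Connected ρ a b →
              type (act a b ρ) ≡ type (act a′ b ρ)
joins-agree {ρ = ρ} {a} {a′} {b} ρ-fpf a∼a′ a≁b =
  type-cong (act-isFPFInvolution a b ρ-fpf) (act-isFPFInvolution a′ b ρ-fpf) (mk⇔
    (Equivalence.from merged′ ∘ Merged-resp a∼a′ ∘ Equivalence.to merged)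
    (Equivalence.from merged ∘ Merged-resp (Connected-sym a∼a′) ∘ Equivalence.to merged′))
  where
  merged : Connected (act a b ρ) x y ⇔ Merged ρ a b x y
  merged = Connected-act⇔Merged ρ-fpf a≁b
  merged′ : Connected (act a′ b ρ) x y ⇔ Merged ρ a′ b x y
  merged′ = Connected-act⇔Merged ρ-fpf (a≁b ∘ (a∼a′ ◅◅_))

-- (a ā) commutes with τ, so it is an isomorphism from the graph of (a ā).ρ to that of ρ.
Connected-act-bar : (a : V n) → Connected (act a (bar a) ρ) x y →
                    Connected ρ (transp a (bar a) x) (transp a (bar a) y)
Connected-act-bar {ρ = ρ} a = EqClosure.gmap (transp a (bar a)) edge
  where
  edge : Edge (act a (bar a) ρ) x y → Edge ρ (transp a (bar a) x) (transp a (bar a) y)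
  edge (inj₁ refl) = inj₁ (transp-involutive a (bar a) _)
  edge {x = x} (inj₂ refl) = inj₂ (transp-bar-comm a x)

-- (ī j).ρ = (i j).ρ₃ for ρ₃ = (i ī).((i j).ρ), and the isomorphism (i ī) turns the separation
-- of ī from j in (i j).ρ into one of i from j in ρ₃, which (i j) then joins.
other-connects : IsFPFInvolution ρ → i ≢ j → bar i ≢ j → ¬ Connected (act i j ρ) i j →
                 Connected (act (bar i) j ρ) (bar i) j
other-connects {ρ = ρ} {i} {j} ρ-fpf i≢j ī≢j i≁₁j =
  Connected-sym (τ-edge i) ◅◅ Connected-resp-≗ ρ₂≗ (Cycle.joins ρ₃-fpf j i≁₃j)
  where
  ρ₁ ρ₃ : V _ → V _
  ρ₁ = act i j ρ
  ρ₃ = act i (bar i) ρ₁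
  ρ₁-fpf : IsFPFInvolution ρ₁
  ρ₁-fpf = act-isFPFInvolution i j ρ-fpf
  ρ₃-fpf : IsFPFInvolution ρ₃
  ρ₃-fpf = act-isFPFInvolution i (bar i) ρ₁-fpf
  i≁₃j : ¬ Connected ρ₃ i j
  i≁₃j c = i≁₁j (τ-edge i ◅◅ subst₂ (Connected ρ₁) (transp-at-a i (bar i))
                                 (transp-fix (i≢j ∘ sym) (ī≢j ∘ sym)) (Connected-act-bar i c))
  conj : ∀ w → transp i j (transp i (bar i) (transp i j w)) ≡ transp (bar i) j w
  conj w = trans (transp-conj (transp i j) (transp-involutive i j) i (bar i) w)
    (trans (cong₂ (λ c d → transp c d w) (transp-at-a i j) (transp-fix (bar-≢ i) ī≢j))
           (sym (transp-comm (bar i) j w)))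
  ρ₂≗ : act i j ρ₃ ≗ act (bar i) j ρ
  ρ₂≗ z = trans (conj (ρ (transp i j (transp i (bar i) (transp i j z)))))
                (cong (transp (bar i) j ∘ ρ) (conj z))

one-of-two-separates : IsFPFInvolution ρ → i ≢ j → bar i ≢ j → Connected ρ i j →
                       ¬ Connected (act i j ρ) i j ⊎ ¬ Connected (act (bar i) j ρ) (bar i) j
one-of-two-separates {i = i} ρ-fpf i≢j ī≢j i∼j with Cycle.on-cycle ρ-fpf i i∼j
... | k , _ , inj₁ j≡uk = inj₁ (Cycle.separates ρ-fpf i {s = k} i≢j (sym j≡uk))
... | k , k≤last , inj₂ j≡vk with Cycle.v-from-bar ρ-fpf i k≤last
...   | d , ūd≡vk = inj₂ (Cycle.separates ρ-fpf (bar i) {s = d} ī≢j (trans ūd≡vk (sym j≡vk)))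

PairedEffects : (ρ : V n → V n) (i j : V n) → Set
PairedEffects ρ i j = (MakesCut ρ i j ⇔ MakesTwist ρ (bar i) j)
                    × (MakesJoin ρ i j ⇔ MakesJoin ρ (bar i) j)
                    × (MakesJoin ρ i j → type (act i j ρ) ≡ type (act (bar i) j ρ))

module _ (ρ : V n → V n) (i j : V n) where

  both-join : MakesJoin ρ i j → MakesJoin ρ (bar i) j → type (act i j ρ) ≡ type (act (bar i) j ρ) →
              PairedEffects ρ i j
  both-join join₁ join₂ types-agree =
    mk⇔ (λ cut₁ → ⊥-elim (join⇒¬cut ρ i j join₁ cut₁))
        (λ twist₂ → ⊥-elim (join⇒¬twist ρ (bar i) j join₂ twist₂)) ,
    mk⇔ (λ _ → join₂) (λ _ → join₁) ,
    (λ _ → types-agree)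

  cut-twist : MakesCut ρ i j → MakesTwist ρ (bar i) j → PairedEffects ρ i j
  cut-twist cut₁ twist₂ =
    mk⇔ (λ _ → twist₂) (λ _ → cut₁) ,
    mk⇔ (λ join₁ → ⊥-elim (join⇒¬cut ρ i j join₁ cut₁))
        (λ join₂ → ⊥-elim (join⇒¬twist ρ (bar i) j join₂ twist₂)) ,
    (λ join₁ → ⊥-elim (join⇒¬cut ρ i j join₁ cut₁))

  twist-cut : MakesTwist ρ i j → MakesCut ρ (bar i) j → PairedEffects ρ i j
  twist-cut twist₁ cut₂ =
    mk⇔ (λ cut₁ → ⊥-elim (cut⇒¬twist ρ i j cut₁ twist₁))
        (λ twist₂ → ⊥-elim (cut⇒¬twist ρ (bar i) j cut₂ twist₂)) ,
    mk⇔ (λ join₁ → ⊥-elim (join⇒¬twist ρ i j join₁ twist₁))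
        (λ join₂ → ⊥-elim (join⇒¬cut ρ (bar i) j join₂ cut₂)) ,
    (λ join₁ → ⊥-elim (join⇒¬twist ρ i j join₁ twist₁))

lemma3p2 : (n : ℕ) → 1 ≤ n → (ρ : V n → V n) → IsFPFInvolution ρ →
           (i j : V n) → i ≢ j → i ≢ bar j →
           (MakesCut ρ i j ⇔ MakesTwist ρ (bar i) j)
           × (MakesJoin ρ i j ⇔ MakesJoin ρ (bar i) j)
           × (MakesJoin ρ i j → type (act i j ρ) ≡ type (act (bar i) j ρ))
lemma3p2 n _ ρ ρ-fpf i j i≢j i≢j̄ = by-connectivity (Connected? ρ-fpf i j)
  where
  ī≢j : bar i ≢ j
  ī≢j = ≢bar⇒bar≢ i≢j̄
  ī∼i : Connected ρ (bar i) i
  ī∼i = Connected-sym (τ-edge i)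
  by-separation : Connected ρ i j →
                  ¬ Connected (act i j ρ) i j ⊎ ¬ Connected (act (bar i) j ρ) (bar i) j → PairedEffects ρ i j
  by-separation i∼j (inj₁ i≁₁j) = cut-twist ρ i j (makes-cut {ρ = ρ} ρ-fpf i≁₁j)
    (makes-twist {ρ = ρ} ρ-fpf (ī∼i ◅◅ i∼j) (other-connects {ρ = ρ} ρ-fpf i≢j ī≢j i≁₁j))
  by-separation i∼j (inj₂ ī≁₂j) = twist-cut ρ i j
    (makes-twist {ρ = ρ} ρ-fpf i∼j (subst (λ a → Connected (act a j ρ) a j) (bar-involutive i)
      (other-connects {ρ = ρ} ρ-fpf ī≢j (i≢j ∘ trans (sym (bar-involutive i))) ī≁₂j)))
    (makes-cut {ρ = ρ} ρ-fpf ī≁₂j)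
  by-connectivity : Dec (Connected ρ i j) → PairedEffects ρ i j
  by-connectivity (no i≁j) =
    both-join ρ i j (makes-join {ρ = ρ} ρ-fpf i≁j) (makes-join {ρ = ρ} ρ-fpf (i≁j ∘ (τ-edge i ◅◅_)))
                    (joins-agree {ρ = ρ} ρ-fpf (τ-edge i) i≁j)
  by-connectivity (yes i∼j) = by-separation i∼j (one-of-two-separates ρ-fpf i≢j ī≢j i∼j)
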